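{- For all integers $n\ge 3$ and $K\ge 1$, the alternate $C_n$ snake with $K$ cycles is a difference graph.
   Context: A graph $G=(V,E)$ is a difference graph if there is a bijection $f$ from $V$ onto a set $S$ of positive integers such that for all distinct $x,y\in V$: $xy\in E$ if and only if $|f(x)-f(y)|\in S$. The alternate $C_n$ snake with $K$ cycles is obtained from a path by replacing every alternate edge by a cycle $C_n$, beginning with an unreplaced edge and ending with a cycle. Explicitly: vertices $u_0,u_1,\dots,u_{Kn}$, with edges $u_iu_{i+1}$ for $0\le i<Kn$ and $u_{kn+1}u_{(k+1)n}$ for $0\le k\le K-1$ (so the $k$-th cycle is $u_{kn+1}u_{kn+2}\cdots u_{(k+1)n}$, and consecutive cycles are joined by the edge $u_{(k+1)n}u_{(k+1)n+1}$, with a pendant edge $u_0u_1$ at the start). -}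

module Defs where

open import Data.Nat using (ℕ; zero; suc; _+_; _*_; _<_; ∣_-_∣)
open import Data.Fin using (Fin; toℕ)
open import Data.Product using (Σ; ∃; _×_)
open import Data.Sum using (_⊎_)
open import Relation.Nullary using (¬_)
open import Relation.Binary.PropositionalEquality using (_≡_)
open import Function.Bundles using (_⇔_)
open import Function.Definitions using (Injective)

record Graph (N : ℕ) : Set₁ where
  field
    Adj : Fin N → Fin N → Set

open Graph public

-- Difference graph: a bijection f from V onto a set S of positive integers
-- (S is the image of f, so f is injective with positive values), such that
-- for distinct x, y: xy ∈ E iff |f x - f y| ∈ S.
IsDifferenceGraph : {N : ℕ} → Graph N → Set
IsDifferenceGraph {N} G =
  Σ (Fin N → ℕ) λ f →
    Injective _≡_ _≡_ f ×
    ((x : Fin N) → 0 < f x) ×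
    ((x y : Fin N) → ¬ (x ≡ y) →
      (Adj G x y ⇔ ∃ λ (z : Fin N) → f z ≡ ∣ f x - f y ∣))

SnakeEdge : (n K : ℕ) → ℕ → ℕ → Set
SnakeEdge n K i j =
  (j ≡ suc i) ⊎
  (∃ λ k → k < K × i ≡ k * n + 1 × j ≡ (suc k) * n)

alternateSnake : (n K : ℕ) → Graph (suc (K * n))
alternateSnake n K = record
  { Adj = λ x y → SnakeEdge n K (toℕ x) (toℕ y) ⊎ SnakeEdge n K (toℕ y) (toℕ x) }

-- Label the vertices by an addition chain g, in which g (i + 1) = g i + g (a i) for some
-- a i ≤ i: then g (i + 1) - g i = g (a i) and g (i + 1) - g (a i) = g i are labels.  Inside a
-- cycle the chain doubles (a i = i), and the step onto the closing vertex u_(k+1)n adds the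
-- label of the first vertex u_(kn+1) of the cycle, so these realised differences are exactly
-- the path edges and the closing chords.  Since every such jump is preceded by a doubling
-- step, any other difference g a - g b lies strictly between two consecutive labels.
module Submission where

open import Defs
open import Data.Empty using (⊥; ⊥-elim)
open import Data.Fin using (Fin; toℕ; fromℕ<)
open import Data.Fin.Properties using (toℕ-injective; toℕ<n; toℕ-fromℕ<)
open import Data.Nat using (ℕ; zero; suc; _+_; _*_; _^_; _∸_; _≤_; _<_; z≤n; s≤s; ∣_-_∣; _≟_)
open import Data.Nat.DivMod using (_%_; _/_; m≡m%n+[m/n]*n; m%n<n; [m+kn]%n≡m%n; m<n⇒m%n≡m; +-distrib-/-∣ʳ; m<n⇒m/n≡0; m*n/n≡m)
open import Data.Nat.Divisibility using (n∣m*n)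
open import Data.Nat.Properties
open import Data.Product using (∃; _×_; _,_)
open import Data.Sum using (_⊎_; inj₁; inj₂; swap)
open import Function.Base using (_∘′_)
open import Function.Bundles using (_⇔_; mk⇔; Equivalence)
open import Function.Construct.Composition using (_⇔-∘_)
open import Function.Construct.Symmetry using (⇔-sym)
open import Relation.Binary.Definitions using (tri<; tri≈; tri>)
open import Relation.Binary.PropositionalEquality using (_≡_; _≢_; refl; sym; trans; cong; cong₂; subst; module ≡-Reasoning)
open import Relation.Nullary using (¬_; yes; no; contradiction)

private
  <-of-+-≡ : ∀ {x y z w} → x + y ≡ z + w → x < z → w < y
  <-of-+-≡ {x} {y} {z} {w} eq x<z = +-cancelˡ-< z w y (begin-strict
    z + w ≡⟨ sym eq ⟩
    x + y <⟨ +-monoˡ-< y x<z ⟩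
    z + y ∎)
    where open ≤-Reasoning

  ≡∣-∣⇔+≡ : ∀ {a b c} → b ≤ a → (c ≡ ∣ a - b ∣) ⇔ (b + c ≡ a)
  ≡∣-∣⇔+≡ {a} {b} {c} b≤a = mk⇔
    (λ c≡ → trans (cong (b +_) (trans c≡ (m≤n⇒∣n-m∣≡n∸m b≤a))) (m+[n∸m]≡n b≤a))
    (λ b+c≡a → trans (sym (m+n∸m≡n b c)) (trans (cong (_∸ b) b+c≡a) (sym (m≤n⇒∣n-m∣≡n∸m b≤a))))

module StrictlyIncreasing (g : ℕ → ℕ) (g-<-suc : ∀ i → g i < g (suc i)) where

  strictMono : ∀ {i j} → i < j → g i < g j
  strictMono {i} {suc j} (s≤s i≤j) with m≤n⇒m<n∨m≡n i≤j
  ... | inj₁ i<j = <-trans (strictMono i<j) (g-<-suc j)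
  ... | inj₂ refl = g-<-suc j

  mono : ∀ {i j} → i ≤ j → g i ≤ g j
  mono i≤j with m≤n⇒m<n∨m≡n i≤j
  ... | inj₁ i<j = <⇒≤ (strictMono i<j)
  ... | inj₂ refl = ≤-refl

  cancel-< : ∀ {i j} → g i < g j → i < j
  cancel-< gi<gj = ≰⇒> (λ j≤i → <⇒≱ gi<gj (mono j≤i))

  cancel-≤ : ∀ {i j} → g i ≤ g j → i ≤ j
  cancel-≤ gi≤gj = ≮⇒≥ (λ j<i → <⇒≱ (strictMono j<i) gi≤gj)

  injective : ∀ {i j} → g i ≡ g j → i ≡ j
  injective eq = ≤-antisym (cancel-≤ (≤-reflexive eq)) (cancel-≤ (≤-reflexive (sym eq)))

  no-value-between : ∀ i c → g i < g c → g c < g (suc i) → ⊥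
  no-value-between i c gi<gc gc<gsi = <⇒≱ (cancel-< gi<gc) (≤-pred (cancel-< gc<gsi))

module AdditionChain (g addend : ℕ → ℕ)
                     (g-suc : ∀ i → g (suc i) ≡ g i + g (addend i))
                     (addend≤ : ∀ i → addend i ≤ i)
                     (0<g0 : 0 < g 0) where

  0<g : ∀ i → 0 < g i
  0<g zero = 0<g0
  0<g (suc i) = ≤-trans (0<g i) (≤-trans (m≤m+n (g i) _) (≤-reflexive (sym (g-suc i))))

  g-<-suc : ∀ i → g i < g (suc i)
  g-<-suc i = <-≤-trans (m<m+n (g i) (0<g (addend i))) (≤-reflexive (sym (g-suc i)))

  open StrictlyIncreasing g g-<-suc public

  module _ (doubling-before-jump : ∀ i → addend (suc i) ≢ suc i → addend i ≡ i) where

    sum-of-terms⇔step : ∀ {a b} → b < a →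
      (∃ λ c → g b + g c ≡ g a) ⇔ (a ≡ suc b ⊎ ∃ λ i → a ≡ suc i × b ≡ addend i)
    sum-of-terms⇔step {suc i} {b} (s≤s b≤i) = mk⇔ to from
      where
      from : (suc i ≡ suc b ⊎ ∃ λ j → suc i ≡ suc j × b ≡ addend j) → ∃ λ c → g b + g c ≡ g (suc i)
      from (inj₁ refl) = addend b , sym (g-suc b)
      from (inj₂ (j , refl , refl)) = j , trans (+-comm (g (addend j)) (g j)) (sym (g-suc j))

      to : (∃ λ c → g b + g c ≡ g (suc i)) → suc i ≡ suc b ⊎ ∃ λ j → suc i ≡ suc j × b ≡ addend j
      to (c , sum) with m≤n⇒m<n∨m≡n b≤i
      ... | inj₂ refl = inj₁ refl
      ... | inj₁ b<i with <-cmp b (addend i)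
      ...   | tri≈ _ b≡a _ = inj₂ (i , refl , b≡a)
      ...   | tri< b<a _ _ = ⊥-elim (no-value-between i c gi<gc gc<gsi)
        where
        gi<gc : g i < g c
        gi<gc = <-of-+-≡ (trans sum (trans (g-suc i) (+-comm (g i) _))) (strictMono b<a)
        gc<gsi : g c < g (suc i)
        gc<gsi = <-≤-trans (m<n+m (g c) (0<g b)) (≤-reflexive sum)
      ...   | tri> _ _ a<b = ⊥-elim (jump-gap i b<i a<b sum)
        where
        jump-gap : ∀ i → b < i → addend i < b → g b + g c ≡ g (suc i) → ⊥
        jump-gap (suc i′) (s≤s b≤i′) a<b sum′ =
          no-value-between i′ c gi′<gc (<-of-+-≡ sum″ (strictMono a<b))
          where
          doubled : g (suc i′) ≡ g i′ + g i′
          doubled = trans (g-suc i′) (cong (λ j → g i′ + g j)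
            (doubling-before-jump i′ (λ eq → <-irrefl eq (<-trans a<b (s≤s b≤i′)))))
          sum″ : g (addend (suc i′)) + g (suc i′) ≡ g b + g c
          sum″ = sym (trans sum′ (trans (g-suc (suc i′)) (+-comm (g (suc i′)) _)))
          gi′<gc : g i′ < g c
          gi′<gc = <-of-+-≡
            (trans sum′ (trans (g-suc (suc i′))
              (trans (cong (_+ g (addend (suc i′))) doubled)
                (trans (+-assoc (g i′) (g i′) _) (+-comm (g i′) _)))))
            (≤-<-trans (mono b≤i′) (m<m+n (g i′) (0<g _)))

isDifferenceGraph-byIncreasingLabels : ∀ {N} (G : Graph N) (g : ℕ → ℕ) →
  (∀ i → 0 < g i) → (∀ i → g i < g (suc i)) →
  (∀ x y → Adj G x y → Adj G y x) →
  (∀ x y → toℕ y < toℕ x → Adj G x y ⇔ ∃ λ c → g (toℕ y) + g c ≡ g (toℕ x)) →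
  IsDifferenceGraph G
isDifferenceGraph-byIncreasingLabels {N} G g 0<g g-<-suc Adj-sym ordered =
  f , toℕ-injective ∘′ injective , (λ x → 0<g (toℕ x)) , adj
  where
  open StrictlyIncreasing g g-<-suc

  f : Fin N → ℕ
  f x = g (toℕ x)

  sum⇔difference : ∀ x y → toℕ y < toℕ x →
    (∃ λ c → g (toℕ y) + g c ≡ g (toℕ x)) ⇔ (∃ λ (z : Fin N) → f z ≡ ∣ f x - f y ∣)
  sum⇔difference x y y<x = mk⇔ to from
    where
    fy≤fx : f y ≤ f x
    fy≤fx = <⇒≤ (strictMono y<x)

    to : (∃ λ c → g (toℕ y) + g c ≡ g (toℕ x)) → ∃ λ (z : Fin N) → f z ≡ ∣ f x - f y ∣
    to (c , sum) = fromℕ< c<N , trans (cong g (toℕ-fromℕ< c<N)) (Equivalence.from (≡∣-∣⇔+≡ fy≤fx) sum)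
      where
      c<N : c < N
      c<N = <-trans (cancel-< (<-≤-trans (m<n+m (g c) (0<g (toℕ y))) (≤-reflexive sum))) (toℕ<n x)

    from : (∃ λ (z : Fin N) → f z ≡ ∣ f x - f y ∣) → ∃ λ c → g (toℕ y) + g c ≡ g (toℕ x)
    from (z , diff) = toℕ z , Equivalence.to (≡∣-∣⇔+≡ fy≤fx) diff

  adj : ∀ x y → ¬ x ≡ y → Adj G x y ⇔ ∃ λ (z : Fin N) → f z ≡ ∣ f x - f y ∣
  adj x y x≢y with <-cmp (toℕ x) (toℕ y)
  ... | tri≈ _ x≡y _ = contradiction (toℕ-injective x≡y) x≢y
  ... | tri> _ _ y<x = sum⇔difference x y y<x ⇔-∘ ordered x y y<x
  ... | tri< x<y _ _ = subst (λ d → Adj G x y ⇔ ∃ λ z → f z ≡ d) (∣-∣-comm (f y) (f x))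
    (sum⇔difference y x x<y ⇔-∘ (ordered y x x<y ⇔-∘ mk⇔ (Adj-sym x y) (Adj-sym y x)))

-- The ratio makes the label
-- of the closing vertex (k + 1) n equal 2 ^ (n - 1) * ratio ^ k + 2 * ratio ^ k, the sum of
-- the labels of its two neighbours in cycle k.
module AlternateSnakeLabels (m : ℕ) where

  n : ℕ
  n = 2 + m

  ratio : ℕ
  ratio = 2 ^ suc m + 2

  label : ℕ → ℕ
  label i = 2 ^ (i % n) * ratio ^ (i / n)

  addendOf : ℕ → ℕ → ℕ
  addendOf r k with suc r ≟ n
  ... | yes _ = k * n + 1
  ... | no _ = r + k * n

  addend : ℕ → ℕ
  addend i = addendOf (i % n) (i / n)

  [r+kn]%n≡r×[r+kn]/n≡k : ∀ {r} k → r < n → (r + k * n) % n ≡ r × (r + k * n) / n ≡ k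
  [r+kn]%n≡r×[r+kn]/n≡k {r} k r<n =
    trans ([m+kn]%n≡m%n r k n) (m<n⇒m%n≡m r<n) ,
    trans (+-distrib-/-∣ʳ r (n∣m*n k)) (cong₂ _+_ (m<n⇒m/n≡0 r<n) (m*n/n≡m k n))

  label-at : ∀ {r} k → r < n → label (r + k * n) ≡ 2 ^ r * ratio ^ k
  label-at k r<n with [r+kn]%n≡r×[r+kn]/n≡k k r<n
  ... | r≡ , k≡ = cong₂ (λ r′ k′ → 2 ^ r′ * ratio ^ k′) r≡ k≡

  addend-at : ∀ {r} k → r < n → addend (r + k * n) ≡ addendOf r k
  addend-at k r<n with [r+kn]%n≡r×[r+kn]/n≡k k r<n
  ... | r≡ , k≡ = cong₂ addendOf r≡ k≡

  data StepFrom : ℕ → Set where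
    doubling : ∀ r k → suc r < n → StepFrom (r + k * n)
    closing : ∀ k → StepFrom (suc m + k * n)

  stepFrom : ∀ i → StepFrom i
  stepFrom i = subst StepFrom (sym (m≡m%n+[m/n]*n i n)) (classify (i % n) (i / n) (m%n<n i n))
    where
    classify : ∀ r k → r < n → StepFrom (r + k * n)
    classify r k (s≤s r≤1+m) with m≤n⇒m<n∨m≡n r≤1+m
    ... | inj₁ r<1+m = doubling r k (s≤s r<1+m)
    ... | inj₂ refl = closing k

  addend-doubling : ∀ {r} k → suc r < n → addend (r + k * n) ≡ r + k * n
  addend-doubling {r} k 1+r<n = trans (addend-at k (<-trans (n<1+n r) 1+r<n)) addendOf-doubling
    where
    addendOf-doubling : addendOf r k ≡ r + k * n
    addendOf-doubling with suc r ≟ n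
    ... | yes 1+r≡n = contradiction 1+r≡n (<⇒≢ 1+r<n)
    ... | no _ = refl

  addend-closing : ∀ k → addend (suc m + k * n) ≡ k * n + 1
  addend-closing k = trans (addend-at k ≤-refl) addendOf-closing
    where
    addendOf-closing : addendOf (suc m) k ≡ k * n + 1
    addendOf-closing with suc (suc m) ≟ n
    ... | yes _ = refl
    ... | no n≢n = contradiction refl n≢n

  label-suc : ∀ i → label (suc i) ≡ label i + label (addend i)
  label-suc i with stepFrom i
  ... | doubling r k 1+r<n = begin
    label (suc r + k * n)              ≡⟨ label-at k 1+r<n ⟩
    2 * 2 ^ r * ratio ^ k              ≡⟨ *-assoc 2 (2 ^ r) _ ⟩
    2 * (2 ^ r * ratio ^ k)            ≡⟨ cong (2 ^ r * ratio ^ k +_) (+-identityʳ _) ⟩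
    2 ^ r * ratio ^ k + 2 ^ r * ratio ^ k
      ≡⟨ cong₂ _+_ (sym (label-at k r<n)) (sym (trans (cong label (addend-doubling k 1+r<n)) (label-at k r<n))) ⟩
    label (r + k * n) + label (addend (r + k * n)) ∎
    where
    open ≡-Reasoning
    r<n : r < n
    r<n = <-trans (n<1+n r) 1+r<n
  ... | closing k = begin
    label (0 + suc k * n)                     ≡⟨ label-at (suc k) (s≤s z≤n) ⟩
    1 * (ratio * ratio ^ k)                   ≡⟨ *-identityˡ _ ⟩
    (2 ^ suc m + 2) * ratio ^ k               ≡⟨ *-distribʳ-+ (ratio ^ k) (2 ^ suc m) 2 ⟩
    2 ^ suc m * ratio ^ k + 2 ^ 1 * ratio ^ k
      ≡⟨ cong₂ _+_ (sym (label-at k ≤-refl)) (sym (label-at k (s≤s (s≤s z≤n)))) ⟩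
    label (suc m + k * n) + label (1 + k * n)
      ≡⟨ cong (λ j → label (suc m + k * n) + label j) (sym (trans (addend-closing k) (+-comm (k * n) 1))) ⟩
    label (suc m + k * n) + label (addend (suc m + k * n)) ∎
    where open ≡-Reasoning

  addend≤ : ∀ i → addend i ≤ i
  addend≤ i with stepFrom i
  ... | doubling r k 1+r<n = ≤-reflexive (addend-doubling k 1+r<n)
  ... | closing k = begin
    addend (suc m + k * n) ≡⟨ trans (addend-closing k) (+-comm (k * n) 1) ⟩
    1 + k * n              ≤⟨ +-monoˡ-≤ (k * n) (s≤s z≤n) ⟩
    suc m + k * n          ∎
    where open ≤-Reasoning

  doubling-before-jump : ∀ i → addend (suc i) ≢ suc i → addend i ≡ i
  doubling-before-jump i jumps with stepFrom i
  ... | doubling r k 1+r<n = addend-doubling k 1+r<n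
  ... | closing k = contradiction (addend-doubling (suc k) (s≤s (s≤s z≤n))) jumps

  0<label0 : 0 < label 0
  0<label0 = ≤-reflexive (sym (label-at 0 (s≤s z≤n)))

  snakeEdge-increasing : ∀ {K i j} → SnakeEdge n K i j → i < j
  snakeEdge-increasing (inj₁ refl) = n<1+n _
  snakeEdge-increasing (inj₂ (k , _ , refl , refl)) =
    subst (_< n + k * n) (+-comm 1 (k * n)) (+-monoˡ-< (k * n) (s≤s (s≤s z≤n)))

  adj⇔snakeEdge : ∀ {K} x y → toℕ y < toℕ x → Adj (alternateSnake n K) x y ⇔ SnakeEdge n K (toℕ y) (toℕ x)
  adj⇔snakeEdge x y y<x =
    mk⇔ (λ { (inj₁ e) → contradiction (snakeEdge-increasing e) (<⇒≯ y<x) ; (inj₂ e) → e }) inj₂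

  snakeEdge⇔step : ∀ K {a b} → a ≤ K * n →
    SnakeEdge n K b a ⇔ (a ≡ suc b ⊎ ∃ λ i → a ≡ suc i × b ≡ addend i)
  snakeEdge⇔step K a≤Kn = mk⇔ to (from a≤Kn)
    where
    to : ∀ {a b} → SnakeEdge n K b a → a ≡ suc b ⊎ ∃ λ i → a ≡ suc i × b ≡ addend i
    to (inj₁ a≡1+b) = inj₁ a≡1+b
    to (inj₂ (k , _ , refl , refl)) = inj₂ (suc m + k * n , refl , sym (addend-closing k))

    from : ∀ {a b} → a ≤ K * n → (a ≡ suc b ⊎ ∃ λ i → a ≡ suc i × b ≡ addend i) → SnakeEdge n K b a
    from _ (inj₁ a≡1+b) = inj₁ a≡1+b
    from a≤Kn (inj₂ (i , refl , refl)) with stepFrom i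
    ... | doubling r k 1+r<n = inj₁ (cong suc (sym (addend-doubling k 1+r<n)))
    ... | closing k = inj₂ (k , *-cancelʳ-≤ (suc k) K n a≤Kn , addend-closing k , refl)

  alternateSnake-isDifferenceGraph : ∀ K → IsDifferenceGraph (alternateSnake n K)
  alternateSnake-isDifferenceGraph K =
    isDifferenceGraph-byIncreasingLabels (alternateSnake n K) label 0<g g-<-suc (λ _ _ → swap) ordered
    where
    open AdditionChain label addend label-suc addend≤ 0<label0

    ordered : ∀ x y → toℕ y < toℕ x →
      Adj (alternateSnake n K) x y ⇔ ∃ λ c → label (toℕ y) + label c ≡ label (toℕ x)
    ordered x y y<x =
      ⇔-sym (sum-of-terms⇔step doubling-before-jump y<x)
        ⇔-∘ (snakeEdge⇔step K (≤-pred (toℕ<n x)) ⇔-∘ adj⇔snakeEdge x y y<x)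

theorem3p9 : (n K : ℕ) → 3 ≤ n → 1 ≤ K → IsDifferenceGraph (alternateSnake n K)
theorem3p9 (suc zero) K (s≤s ()) _
theorem3p9 (suc (suc m)) K _ _ = AlternateSnakeLabels.alternateSnake-isDifferenceGraph m K
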